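{- If $d$ and $e$ are degree sequences with a common sum satisfying $d\succeq e$, then $\Delta^*(d)\le\Delta^*(e)$.
   Context: Degree sequences are written in nonincreasing order (padded with zeros to a common length when compared). For degree sequences $d,e$ with the same sum, $d\succeq e$ ($d$ majorizes $e$) means $\sum_{i\le k}d_i\ge\sum_{i\le k}e_i$ for all $k$. $m(d)=\max\{i:d_i\ge i-1\}$, $\Delta_k(d)=k(k-1)+\sum_{i>k}\min\{k,d_i\}-\sum_{i\le k}d_i$, and $\Delta^*(d)=\max\{\Delta_k(d):1\le k\le m(d)\}$. -}

module Defs where

open import Data.Bool using (Bool; true; false; if_then_else_)
open import Data.Nat using (ℕ; zero; suc; _+_; _*_; _∸_; _≤_; _≥_; _⊓_; _≤?_)
open import Data.Integer using (ℤ; +_; _-_; _⊔_)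
open import Data.Fin using (Fin)
open import Data.Nat.ListAction using (sum)
open import Data.List using (List; []; _∷_; length; map; take; drop; lookup; allFin)
open import Data.List.Relation.Unary.Linked using (Linked)
open import Data.Product using (Σ; _×_)
open import Relation.Binary.PropositionalEquality using (_≡_)
open import Relation.Nullary using (yes; no)

record SimpleGraph (n : ℕ) : Set where
  field
    adj   : Fin n → Fin n → Bool
    sym   : ∀ i j → adj i j ≡ adj j i
    irrefl : ∀ i → adj i i ≡ false

open SimpleGraph public

degree : ∀ {n} → SimpleGraph n → Fin n → ℕ
degree {n} G i = sum (map (λ j → if adj G i j then 1 else 0) (allFin n))

Nonincreasing : List ℕ → Set
Nonincreasing = Linked _≥_

IsDegreeSequence : List ℕ → Set
IsDegreeSequence d =
  Nonincreasing d × Σ (SimpleGraph (length d)) (λ G → ∀ i → degree G i ≡ lookup d i)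

-- d majorizes e (with implicit zero padding): equal sums and all prefix sums
-- of d dominate those of e.
_≽_ : List ℕ → List ℕ → Set
d ≽ e = sum d ≡ sum e × (∀ k → sum (take k e) ≤ sum (take k d))

-- 0-indexed access with zero padding: nth d n = d_{n+1}.
nth : List ℕ → ℕ → ℕ
nth []       _       = 0
nth (x ∷ xs) zero    = x
nth (x ∷ xs) (suc n) = nth xs n

-- largest i ≤ N (1-indexed) with d_i ≥ i - 1, or 0 if none
mSearch : List ℕ → ℕ → ℕ
mSearch d zero = zero
mSearch d (suc n) with n ≤? nth d n
... | yes _ = suc n
... | no  _ = mSearch d n

-- m(d) = max { i : d_i ≥ i - 1 }; indices beyond length d + 1 never qualify
-- (padding zeros), and i = 1 always qualifies, so m(d) ≥ 1.
m : List ℕ → ℕ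
m d = mSearch d (suc (length d))

Δ : List ℕ → ℕ → ℤ
Δ d k = + (k * (k ∸ 1) + sum (map (k ⊓_) (drop k d))) - + sum (take k d)

-- maxUpTo f n = max { f k : 1 ≤ k ≤ n + 1 }
maxUpTo : (ℕ → ℤ) → ℕ → ℤ
maxUpTo f zero    = f 1
maxUpTo f (suc n) = f (suc (suc n)) ⊔ maxUpTo f n

-- Δ*(d) = max { Δ_k(d) : 1 ≤ k ≤ m(d) }   (m(d) ≥ 1 always)
Δ* : List ℕ → ℤ
Δ* d = maxUpTo (Δ d) (m d ∸ 1)

-- Write s for the common sum, S_k(x) for the k-th prefix sum, T_k(x) = Σ_{i>k} min{k, x_i}
-- and P_k(x) = Σ_{i>k} (x_i − k)⁺, so that T_k + S_k + P_k = s and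
-- Δ_k(x) = k(k−1) + s − (2 S_k(x) + P_k(x)).
-- For a nonincreasing tail S_k + P_k = max_j (S_{k+j} − jk), so majorization gives
-- S_k(e) + P_k(e) ≤ S_k(d) + P_k(d), hence Δ_k(d) ≤ Δ_k(e) for every k; this settles k ≤ m(e).
-- For p = m(e) ≤ k ≤ m(d): the entries of e beyond p are at most p, so P_p(e) = 0, while
-- d_i ≥ k − 1 for i ≤ k gives S_k(d) ≥ S_p(d) + (k − p)(k − 1). With the identity
-- k(k−1) + (k−p)(k−p−1) = p(p−1) + 2(k−p)(k−1) this yields Δ_k(d) ≤ Δ_p(e).
module Submission where

open import Defs
open import Data.List using (List)
open import Data.Nat using (ℕ)
open import Data.Integer using (_≤_)

open import Data.Integer using (_-_; _⊖_) renaming (+_ to +[_])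
import Data.Integer.Properties as ℤ
open import Data.List using ([]; _∷_; take; drop; map; length)
import Data.List.Properties as List
open import Data.List.Relation.Unary.Linked as Linked using (_∷_)
open import Data.Nat using (zero; suc; _+_; _*_; _∸_; _⊓_; _≤?_; _<?_; z≤n; s≤s)
  renaming (_≤_ to _≤ₙ_; _<_ to _<ₙ_)
open import Data.Nat.ListAction using (sum)
open import Data.Nat.ListAction.Properties using (sum-++)
open import Data.Nat.Properties
open import Algebra.Properties.CommutativeSemigroup +-commutativeSemigroup
  using (interchange; x∙yz≈y∙xz; xy∙z≈xz∙y)
open import Data.Nat.Tactic.RingSolver using (solve-∀)
open import Data.Product using (_,_; ∃)
open import Data.Sum using (inj₁; inj₂)
open import Relation.Binary.PropositionalEquality
  using (_≡_; refl; trans; cong; cong₂; subst; module ≡-Reasoning)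
import Relation.Binary.PropositionalEquality as ≡
open import Relation.Nullary using (¬_; yes; no; contradiction)

sum-take+sum-drop : ∀ k (xs : List ℕ) → sum (take k xs) + sum (drop k xs) ≡ sum xs
sum-take+sum-drop k xs =
  trans (≡.sym (sum-++ (take k xs) (drop k xs))) (cong sum (List.take++drop≡id k xs))

sum-take-+ : ∀ k j (xs : List ℕ) →
             sum (take (k + j) xs) ≡ sum (take k xs) + sum (take j (drop k xs))
sum-take-+ zero    j       xs       = refl
sum-take-+ (suc k) zero    []       = refl
sum-take-+ (suc k) (suc j) []       = refl
sum-take-+ (suc k) j       (x ∷ xs) =
  trans (cong (x +_) (sum-take-+ k j xs)) (≡.sym (+-assoc x _ _))

*≤sum-take : ∀ n c (xs : List ℕ) → (∀ i → i <ₙ n → c ≤ₙ nth xs i) → n * c ≤ₙ sum (take n xs)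
*≤sum-take zero    c xs       c≤xs = z≤n
*≤sum-take (suc n) c []       c≤xs with c≤xs 0 (s≤s z≤n)
... | z≤n = ≤-reflexive (*-zeroʳ (suc n))
*≤sum-take (suc n) c (x ∷ xs) c≤xs =
  +-mono-≤ (c≤xs 0 (s≤s z≤n)) (*≤sum-take n c xs (λ i i<n → c≤xs (suc i) (s≤s i<n)))

nth-drop : ∀ k (xs : List ℕ) i → nth (drop k xs) i ≡ nth xs (k + i)
nth-drop zero    xs       i = refl
nth-drop (suc k) []       i = refl
nth-drop (suc k) (x ∷ xs) i = nth-drop k xs i

nth-beyond-length : ∀ (xs : List ℕ) i → length xs ≤ₙ i → nth xs i ≡ 0
nth-beyond-length []       i       _         = refl
nth-beyond-length (x ∷ xs) (suc i) (s≤s len≤i) = nth-beyond-length xs i len≤i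

excess : ℕ → List ℕ → ℕ
excess k xs = sum (map (_∸ k) xs)

sum-⊓+excess : ∀ k xs → sum (map (k ⊓_) xs) + excess k xs ≡ sum xs
sum-⊓+excess k []       = refl
sum-⊓+excess k (x ∷ xs) = begin
  (k ⊓ x + sum (map (k ⊓_) xs)) + (x ∸ k + excess k xs) ≡⟨ interchange (k ⊓ x) _ (x ∸ k) _ ⟩
  (k ⊓ x + (x ∸ k)) + (sum (map (k ⊓_) xs) + excess k xs)
    ≡⟨ cong₂ _+_ (m⊓n+n∸m≡n k x) (sum-⊓+excess k xs) ⟩
  x + sum xs                                             ∎
  where open ≡-Reasoning

sum-take≤excess+* : ∀ k xs j → sum (take j xs) ≤ₙ excess k xs + j * k
sum-take≤excess+* k xs       zero    = z≤n
sum-take≤excess+* k []       (suc j) = z≤n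
sum-take≤excess+* k (x ∷ xs) (suc j) = begin
  x + sum (take j xs)                   ≤⟨ +-mono-≤ (m≤n+m∸n x k) (sum-take≤excess+* k xs j) ⟩
  (k + (x ∸ k)) + (excess k xs + j * k) ≡⟨ cong (_+ (excess k xs + j * k)) (+-comm k (x ∸ k)) ⟩
  (x ∸ k + k) + (excess k xs + j * k)   ≡⟨ interchange (x ∸ k) k (excess k xs) (j * k) ⟩
  (x ∸ k + excess k xs) + (k + j * k)   ∎
  where open ≤-Reasoning

tail⊓+prefix+excess : ∀ n k (xs : List ℕ) →
  n + sum (map (k ⊓_) (drop k xs)) + (sum (take k xs) + excess k (drop k xs)) ≡ n + sum xs
tail⊓+prefix+excess n k xs = begin
  n + T + (S + P)   ≡⟨ +-assoc n T (S + P) ⟩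
  n + (T + (S + P)) ≡⟨ cong (n +_) (x∙yz≈y∙xz T S P) ⟩
  n + (S + (T + P)) ≡⟨ cong (λ t → n + (S + t)) (sum-⊓+excess k (drop k xs)) ⟩
  n + (S + sum (drop k xs)) ≡⟨ cong (n +_) (sum-take+sum-drop k xs) ⟩
  n + sum xs        ∎
  where
  open ≡-Reasoning
  T = sum (map (k ⊓_) (drop k xs))
  S = sum (take k xs)
  P = excess k (drop k xs)

nth≤head : ∀ {x xs} → Nonincreasing (x ∷ xs) → ∀ j → nth xs j ≤ₙ x
nth≤head {xs = []}     _             j       = z≤n
nth≤head {xs = y ∷ ys} (x≥y ∷ y∷ys↓) zero    = x≥y
nth≤head {xs = y ∷ ys} (x≥y ∷ y∷ys↓) (suc j) = ≤-trans (nth≤head y∷ys↓ j) x≥y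

nth-antimono : ∀ {xs} → Nonincreasing xs → ∀ {i j} → i ≤ₙ j → nth xs j ≤ₙ nth xs i
nth-antimono {[]}     _   _                           = z≤n
nth-antimono {x ∷ xs} xs↓ {zero}  {zero}  _         = ≤-refl
nth-antimono {x ∷ xs} xs↓ {zero}  {suc j} _         = nth≤head xs↓ j
nth-antimono {x ∷ xs} xs↓ {suc i} {suc j} (s≤s i≤j) = nth-antimono (Linked.tail xs↓) i≤j

Nonincreasing-drop : ∀ k {xs} → Nonincreasing xs → Nonincreasing (drop k xs)
Nonincreasing-drop zero    xs↓          = xs↓
Nonincreasing-drop (suc k) {[]}     xs↓ = xs↓
Nonincreasing-drop (suc k) {x ∷ xs} xs↓ = Nonincreasing-drop k (Linked.tail xs↓)

excess≡0 : ∀ k {xs} → Nonincreasing xs → nth xs 0 ≤ₙ k → excess k xs ≡ 0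
excess≡0 k {[]}     _   _   = refl
excess≡0 k {x ∷ xs} xs↓ x≤k =
  cong₂ _+_ (m≤n⇒m∸n≡0 x≤k) (excess≡0 k (Linked.tail xs↓) (≤-trans (nth≤head xs↓ 0) x≤k))

-- The bound sum-take≤excess+* is attained at j = number of entries exceeding k.
excess-attained : ∀ k {xs} → Nonincreasing xs → ∃ λ j → excess k xs + j * k ≤ₙ sum (take j xs)
excess-attained k {[]}     _   = 0 , z≤n
excess-attained k {x ∷ xs} xs↓ with x ≤? k
... | yes x≤k = 0 , ≤-reflexive (trans (+-identityʳ _) (excess≡0 k xs↓ x≤k))
... | no  x≰k with excess-attained k (Linked.tail xs↓)
...   | j , attained = suc j , (begin
  (x ∸ k + excess k xs) + (k + j * k) ≡⟨ interchange (x ∸ k) (excess k xs) k (j * k) ⟩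
  (x ∸ k + k) + (excess k xs + j * k) ≡⟨ cong (_+ (excess k xs + j * k)) (m∸n+n≡m (<⇒≤ (≰⇒> x≰k))) ⟩
  x + (excess k xs + j * k)           ≤⟨ +-monoʳ-≤ x attained ⟩
  x + sum (take j xs)                 ∎)
  where open ≤-Reasoning

prefix+excess-mono : ∀ {d e} → Nonincreasing e → d ≽ e → ∀ k →
  sum (take k e) + excess k (drop k e) ≤ₙ sum (take k d) + excess k (drop k d)
prefix+excess-mono {d} {e} e↓ (_ , maj) k with excess-attained k (Nonincreasing-drop k e↓)
... | j , attained = +-cancelʳ-≤ (j * k) _ _ (begin
  sum (take k e) + excess k (drop k e) + j * k   ≡⟨ +-assoc (sum (take k e)) _ _ ⟩
  sum (take k e) + (excess k (drop k e) + j * k) ≤⟨ +-monoʳ-≤ (sum (take k e)) attained ⟩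
  sum (take k e) + sum (take j (drop k e))       ≡⟨ sum-take-+ k j e ⟨
  sum (take (k + j) e)                           ≤⟨ maj (k + j) ⟩
  sum (take (k + j) d)                           ≡⟨ sum-take-+ k j d ⟩
  sum (take k d) + sum (take j (drop k d))
    ≤⟨ +-monoʳ-≤ (sum (take k d)) (sum-take≤excess+* k (drop k d) j) ⟩
  sum (take k d) + (excess k (drop k d) + j * k) ≡⟨ +-assoc (sum (take k d)) _ _ ⟨
  sum (take k d) + excess k (drop k d) + j * k   ∎)
  where open ≤-Reasoning

mSearch-sound : ∀ d N → mSearch d N ∸ 1 ≤ₙ nth d (mSearch d N ∸ 1)
mSearch-sound d zero    = z≤n
mSearch-sound d (suc n) with n ≤? nth d n
... | yes n≤dₙ = n≤dₙ
... | no  _    = mSearch-sound d n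

mSearch-maximal : ∀ d N i → mSearch d N ≤ₙ i → i <ₙ N → ¬ (i ≤ₙ nth d i)
mSearch-maximal d (suc n) i mS≤i i<N with n ≤? nth d n
... | yes _   = contradiction (<-≤-trans i<N mS≤i) (<-irrefl refl)
... | no  n≰dₙ with m<1+n⇒m<n∨m≡n i<N
...   | inj₁ i<n  = mSearch-maximal d n i mS≤i i<n
...   | inj₂ refl = n≰dₙ

m-pos : ∀ d → 1 ≤ₙ m d
m-pos d = go (length d)
  where
  go : ∀ n → 1 ≤ₙ mSearch d (suc n)
  go zero    with 0 ≤? nth d 0
  ... | yes _   = s≤s z≤n
  ... | no  0≰d₀ = contradiction z≤n 0≰d₀
  go (suc n) with suc n ≤? nth d (suc n)
  ... | yes _ = s≤s z≤n
  ... | no  _ = go n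

nth-m<m : ∀ d → nth d (m d) <ₙ m d
nth-m<m d with m d <? suc (length d)
... | yes m<N = ≰⇒> (mSearch-maximal d (suc (length d)) (m d) ≤-refl m<N)
... | no  m≮N = subst (_<ₙ m d) (≡.sym (nth-beyond-length d (m d) (<⇒≤ (≮⇒≥ m≮N)))) (m-pos d)

pred≤nth-below-m : ∀ {d} → Nonincreasing d → ∀ {k i} → k ≤ₙ m d → i <ₙ k → k ∸ 1 ≤ₙ nth d i
pred≤nth-below-m {d} d↓ {k} {i} k≤m i<k = begin
  k ∸ 1               ≤⟨ ∸-monoˡ-≤ 1 k≤m ⟩
  m d ∸ 1             ≤⟨ mSearch-sound d (suc (length d)) ⟩
  nth d (m d ∸ 1)     ≤⟨ nth-antimono d↓ (∸-monoˡ-≤ 1 (≤-trans i<k k≤m)) ⟩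
  nth d i             ∎
  where open ≤-Reasoning

maxUpTo-upper : ∀ f n k → 1 ≤ₙ k → k ≤ₙ suc n → f k ≤ maxUpTo f n
maxUpTo-upper f zero    .1 (s≤s z≤n) (s≤s z≤n) = ℤ.≤-refl
maxUpTo-upper f (suc n) k  1≤k       k≤n+2 with k ≤? suc n
... | yes k≤n+1 = ℤ.≤-trans (maxUpTo-upper f n k 1≤k k≤n+1) (ℤ.i≤j⊔i _ _)
... | no  k≰n+1 with ≤-antisym k≤n+2 (≰⇒> k≰n+1)
...   | refl = ℤ.i≤i⊔j _ _

maxUpTo-least : ∀ f n c → (∀ k → 1 ≤ₙ k → k ≤ₙ suc n → f k ≤ c) → maxUpTo f n ≤ c
maxUpTo-least f zero    c f≤c = f≤c 1 (s≤s z≤n) (s≤s z≤n)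
maxUpTo-least f (suc n) c f≤c = ℤ.⊔-lub (f≤c (suc (suc n)) (s≤s z≤n) ≤-refl)
  (maxUpTo-least f n c (λ k 1≤k k≤n+1 → f≤c k 1≤k (m≤n⇒m≤1+n k≤n+1)))

suc[m∸1]≡m : ∀ d → suc (m d ∸ 1) ≡ m d
suc[m∸1]≡m d = trans (+-comm 1 (m d ∸ 1)) (m∸n+n≡m (m-pos d))

Δ≤Δ* : ∀ d {k} → 1 ≤ₙ k → k ≤ₙ m d → Δ d k ≤ Δ* d
Δ≤Δ* d {k} 1≤k k≤m =
  maxUpTo-upper (Δ d) (m d ∸ 1) k 1≤k (subst (k ≤ₙ_) (≡.sym (suc[m∸1]≡m d)) k≤m)

Δ*-least : ∀ d {c} → (∀ k → 1 ≤ₙ k → k ≤ₙ m d → Δ d k ≤ c) → Δ* d ≤ c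
Δ*-least d {c} Δ≤c = maxUpTo-least (Δ d) (m d ∸ 1) c
  (λ k 1≤k k≤m → Δ≤c k 1≤k (subst (k ≤ₙ_) (suc[m∸1]≡m d) k≤m))

[+a]-[+b]≤[+c]-[+d] : ∀ a b c d {u v} → a + u ≡ c + v → v + d ≤ₙ u + b → +[ a ] - +[ b ] ≤ +[ c ] - +[ d ]
[+a]-[+b]≤[+c]-[+d] a b c d {u} {v} balance v+d≤u+b = begin
  +[ a ] - +[ b ]   ≡⟨ ℤ.[+m]-[+n]≡m⊖n a b ⟩
  a ⊖ b             ≡⟨ ℤ.+-cancelˡ-⊖ u a b ⟨
  (u + a) ⊖ (u + b) ≡⟨ cong (_⊖ (u + b)) (trans (+-comm u a) (trans balance (+-comm c v))) ⟩
  (v + c) ⊖ (u + b) ≤⟨ ℤ.⊖-monoʳ-≥-≤ (v + c) v+d≤u+b ⟩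
  (v + c) ⊖ (v + d) ≡⟨ ℤ.+-cancelˡ-⊖ v c d ⟩
  c ⊖ d             ≡⟨ ℤ.[+m]-[+n]≡m⊖n c d ⟨
  +[ c ] - +[ d ]   ∎
  where open ℤ.≤-Reasoning

Δ-antitone : ∀ {d e} → Nonincreasing e → d ≽ e → ∀ k → Δ d k ≤ Δ e k
Δ-antitone {d} {e} e↓ d≽e@(sum≡ , maj) k =
  [+a]-[+b]≤[+c]-[+d] (K + T d) (sum (take k d)) (K + T e) (sum (take k e))
    balance (+-mono-≤ (prefix+excess-mono e↓ d≽e k) (maj k))
  where
  K = k * (k ∸ 1)
  T : List ℕ → ℕ
  T x = sum (map (k ⊓_) (drop k x))
  balance : K + sum (map (k ⊓_) (drop k d)) + (sum (take k d) + excess k (drop k d))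
          ≡ K + sum (map (k ⊓_) (drop k e)) + (sum (take k e) + excess k (drop k e))
  balance = begin
    K + sum (map (k ⊓_) (drop k d)) + (sum (take k d) + excess k (drop k d)) ≡⟨ tail⊓+prefix+excess K k d ⟩
    K + sum d ≡⟨ cong (K +_) sum≡ ⟩
    K + sum e ≡⟨ tail⊓+prefix+excess K k e ⟨
    K + sum (map (k ⊓_) (drop k e)) + (sum (take k e) + excess k (drop k e)) ∎
    where open ≡-Reasoning

*-pred-split : ∀ p r → (p + r) * (p + r ∸ 1) + r * (r ∸ 1)
                     ≡ p * (p ∸ 1) + (r * (p + r ∸ 1) + r * (p + r ∸ 1))
*-pred-split zero    r       = refl
*-pred-split (suc a) zero    rewrite +-identityʳ a = refl
*-pred-split (suc a) (suc q) = polynomial a q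
  where
  polynomial : ∀ a q → suc (a + suc q) * (a + suc q) + suc q * q
                     ≡ suc a * a + (suc q * (a + suc q) + suc q * (a + suc q))
  polynomial = solve-∀

Δ-beyond : ∀ {d e} → Nonincreasing d → Nonincreasing e → d ≽ e →
           ∀ {p k} → nth e p ≤ₙ p → p ≤ₙ k → k ≤ₙ m d → Δ d k ≤ Δ e p
Δ-beyond {d} {e} d↓ e↓ (sum≡ , maj) {p} eₚ≤p p≤k k≤m with m≤n⇒∃[o]m+o≡n p≤k
... | r , refl =
  [+a]-[+b]≤[+c]-[+d] (K + T k d) (S k d) (Kₚ + T p e) (S p e) balance dominance
  where
  k = p + r
  K = k * (k ∸ 1)
  Kₚ = p * (p ∸ 1)
  M = r * (k ∸ 1)

  T S P : ℕ → List ℕ → ℕ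
  T n x = sum (map (n ⊓_) (drop n x))
  S n x = sum (take n x)
  P n x = excess n (drop n x)

  balance : K + T k d + (S k d + P k d + r * (r ∸ 1)) ≡ Kₚ + T p e + (S p e + P p e + (M + M))
  balance = begin
    K + T k d + (S k d + P k d + r * (r ∸ 1)) ≡⟨ +-assoc (K + T k d) _ _ ⟨
    K + T k d + (S k d + P k d) + r * (r ∸ 1) ≡⟨ cong (_+ r * (r ∸ 1)) (tail⊓+prefix+excess K k d) ⟩
    K + sum d + r * (r ∸ 1)                   ≡⟨ xy∙z≈xz∙y K (sum d) _ ⟩
    K + r * (r ∸ 1) + sum d                   ≡⟨ cong₂ _+_ (*-pred-split p r) sum≡ ⟩
    Kₚ + (M + M) + sum e                      ≡⟨ xy∙z≈xz∙y Kₚ (M + M) (sum e) ⟩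
    Kₚ + sum e + (M + M)                      ≡⟨ cong (_+ (M + M)) (tail⊓+prefix+excess Kₚ p e) ⟨
    Kₚ + T p e + (S p e + P p e) + (M + M)    ≡⟨ +-assoc (Kₚ + T p e) _ _ ⟩
    Kₚ + T p e + (S p e + P p e + (M + M))    ∎
    where open ≡-Reasoning

  M≤middle : M ≤ₙ sum (take r (drop p d))
  M≤middle = *≤sum-take r (k ∸ 1) (drop p d) λ i i<r →
    subst (k ∸ 1 ≤ₙ_) (≡.sym (nth-drop p d i)) (pred≤nth-below-m d↓ k≤m (+-monoʳ-< p i<r))

  Sₚe+M≤Sₖd : S p e + M ≤ₙ S k d
  Sₚe+M≤Sₖd = begin
    S p e + M                        ≤⟨ +-mono-≤ (maj p) M≤middle ⟩
    S p d + sum (take r (drop p d))  ≡⟨ sum-take-+ p r d ⟨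
    S k d                            ∎
    where open ≤-Reasoning

  Pₚe≡0 : P p e ≡ 0
  Pₚe≡0 = excess≡0 p (Nonincreasing-drop p e↓)
    (subst (_≤ₙ p) (≡.sym (trans (nth-drop p e 0) (cong (nth e) (+-identityʳ p)))) eₚ≤p)

  dominance : S p e + P p e + (M + M) + S p e ≤ₙ S k d + P k d + r * (r ∸ 1) + S k d
  dominance = begin
    S p e + P p e + (M + M) + S p e  ≡⟨ cong (λ x → S p e + x + (M + M) + S p e) Pₚe≡0 ⟩
    S p e + 0 + (M + M) + S p e      ≡⟨ regroup (S p e) M ⟩
    (S p e + M) + (S p e + M)        ≤⟨ +-mono-≤ Sₚe+M≤Sₖd Sₚe+M≤Sₖd ⟩
    S k d + S k d                    ≤⟨ +-monoˡ-≤ (S k d) (≤-trans (m≤m+n _ _) (m≤m+n _ _)) ⟩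
    S k d + P k d + r * (r ∸ 1) + S k d ∎
    where
    open ≤-Reasoning
    regroup : ∀ s x → s + 0 + (x + x) + s ≡ (s + x) + (s + x)
    regroup = solve-∀

theorem4p8 : (d e : List ℕ) → IsDegreeSequence d → IsDegreeSequence e →
               d ≽ e → Δ* d ≤ Δ* e
theorem4p8 d e (d↓ , _) (e↓ , _) d≽e = Δ*-least d Δd≤Δ*e
  where
  Δd≤Δ*e : ∀ k → 1 ≤ₙ k → k ≤ₙ m d → Δ d k ≤ Δ* e
  Δd≤Δ*e k 1≤k k≤mᵈ with ≤-total k (m e)
  ... | inj₁ k≤mᵉ = ℤ.≤-trans (Δ-antitone e↓ d≽e k) (Δ≤Δ* e 1≤k k≤mᵉ)
  ... | inj₂ mᵉ≤k = ℤ.≤-trans (Δ-beyond d↓ e↓ d≽e (<⇒≤ (nth-m<m e)) mᵉ≤k k≤mᵈ)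
                              (Δ≤Δ* e (m-pos e) ≤-refl)
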